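{- Let $p$ be an odd prime, $v$ an $n$-dimensional integral vector each of whose entries is nonzero modulo $p$, and $u$ the shortest $p$-representative of $v$. Suppose that $u^{\mathrm T}e-p=sp$ for some $s\in\{ -3,-2,\ldots,3\}$ and $u^{\mathrm T}u\le p^2$. Then every perfect $p$-representative $w$ of $v$ can be written as $$w=u+\sum_{i\in I}pe_i-\sum_{j\in D}pe_j,$$ where $I$ and $D$ are disjoint (possibly empty) subsets of $\{1,2,\ldots,n\}$ satisfying: (i) $|I|+|D|\le 3$; (ii) $|D|-|I|=s$; (iii) $u_i<0$ for each $i\in I$ and $u_j>0$ for each $j\in D$; and (iv) $\sum_{k\in I\cup D}|u_k|=\frac{1}{2p}u^{\mathrm T}u+\frac{p}{2}(|I|+|D|-1)$.
   Context: $e$ is the all-one vector and $e_i$ the $i$-th standard unit vector in $\mathbb{R}^n$. For integral vectors $v,w$: $w$ is a perfect $p$-representative of $v$ if $w\equiv v\pmod p$, $w^{\mathrm T}e=p$ and $w^{\mathrm T}w=p^2$; $w$ is the shortest $p$-representative of $v$ if $w\equiv v\pmod p$ and $|w_i|\le\frac{p-1}{2}$ for every entry $w_i$. -}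

module Defs where

open import Data.Nat as ℕ using (ℕ)
open import Data.Integer as ℤ using (ℤ; +_; _+_; _-_; _*_; ∣_∣)
open import Data.Integer.Divisibility using (_∣_)
open import Data.Fin using (Fin; zero; suc)
open import Data.Fin.Subset using (Subset; _∈_; _∉_; _∪_)
open import Data.Vec using (lookup)
open import Data.Bool using (if_then_else_)
open import Data.Product using (_×_)
open import Relation.Binary.PropositionalEquality using (_≡_)

IVec : ℕ → Set
IVec n = Fin n → ℤ

Σ : ∀ {n} → (Fin n → ℤ) → ℤ
Σ {ℕ.zero}  f = + 0
Σ {ℕ.suc n} f = f zero + Σ (λ i → f (suc i))

e : ∀ {n} → IVec n
e _ = + 1

_·_ : ∀ {n} → IVec n → IVec n → ℤ
x · y = Σ (λ i → x i * y i)

_≡[mod_]_ : ∀ {n} → IVec n → ℕ → IVec n → Set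
w ≡[mod p ] v = ∀ i → + p ∣ (w i - v i)

IsPerfectRep : ∀ {n} → ℕ → IVec n → IVec n → Set
IsPerfectRep p v w = (w ≡[mod p ] v) × (w · e ≡ + p) × (w · w ≡ + (p ℕ.* p))

IsShortestRep : ∀ {n} → ℕ → IVec n → IVec n → Set
IsShortestRep p v w = (w ≡[mod p ] v) × (∀ i → ∣ w i ∣ ℕ.≤ (p ℕ.∸ 1) ℕ./ 2)

-- indicator vector of a subset: Σ_{i∈S} e_i
χ : ∀ {n} → Subset n → IVec n
χ S i = if lookup S i then + 1 else + 0

Disjoint : ∀ {n} → Subset n → Subset n → Set
Disjoint I D = ∀ i → i ∈ I → i ∉ D

card : ∀ {n} → Subset n → ℤ
card S = + (Data.Fin.Subset.∣_∣ S)

-- Write w = u + p k entrywise. As |uᵢ| < p/2 and |wᵢ| ≤ √(w·w) = p, each kᵢ ∈ {-1, 0, 1}, and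
-- kᵢ = 1 forces uᵢ < 0, kᵢ = -1 forces uᵢ > 0; I and D are the entries moved up and down.
-- A moved entry has |wᵢ| = p - |uᵢ| ≥ (p+1)/2, so 4wᵢ² ≥ (p+1)², and w·w = p² leaves room
-- for at most three of them. Summing w = u + p(χ_I - χ_D) gives |D| - |I| = s, and summing
-- uᵢ² - wᵢ² + p² = 2p|uᵢ| over the moved entries gives (iv).
module Submission where

open import Defs
open import Data.Nat as ℕ using (ℕ; zero; suc; z≤n; s≤s)
import Data.Nat.Properties as ℕP
open import Data.Nat.DivMod using (_/_; m/n*n≤m)
open import Data.Nat.Divisibility using () renaming (_∣_ to _∣ℕ_)
open import Data.Nat.Primality using (Prime; ¬prime[0])
open import Data.Integer using (ℤ; +_; -_; _+_; _-_; _*_; ∣_∣; _≤_; _<_; -[1+_]; +[1+_]; +≤+; +<+; -<+)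
import Data.Integer.Properties as ℤP
open import Data.Integer.Divisibility using (_∣_)
import Data.Integer.Divisibility.Signed as Signed
open import Data.Integer.Tactic.RingSolver using (solve-∀)
open import Algebra.Properties.CommutativeSemigroup ℤP.+-commutativeSemigroup using (interchange)
open import Data.Fin using (Fin; zero; suc)
open import Data.Fin.Subset using (Subset; _∈_; _∪_)
open import Data.Vec using ([]; _∷_; tabulate)
import Data.Vec.Properties as VP
open import Data.Bool using (Bool; true; false; if_then_else_; _∨_)
open import Data.Product using (Σ-syntax; _×_; _,_)
open import Data.Empty using (⊥-elim)
open import Function using (_∘_)
open import Relation.Nullary using (¬_)
open import Relation.Binary.PropositionalEquality
  using (_≡_; _≢_; refl; sym; trans; cong; cong₂; subst; subst₂; module ≡-Reasoning)

Σ-cong : ∀ {n} {f g : Fin n → ℤ} → (∀ i → f i ≡ g i) → Σ f ≡ Σ g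
Σ-cong {zero}  f≗g = refl
Σ-cong {suc n} f≗g = cong₂ _+_ (f≗g zero) (Σ-cong (f≗g ∘ suc))

Σ-distrib-+ : ∀ {n} (f g : Fin n → ℤ) → Σ (λ i → f i + g i) ≡ Σ f + Σ g
Σ-distrib-+ {zero}  f g = refl
Σ-distrib-+ {suc n} f g =
  trans (cong (_+_ (f zero + g zero)) (Σ-distrib-+ (f ∘ suc) (g ∘ suc)))
        (interchange (f zero) (g zero) _ _)

Σ-neg : ∀ {n} (f : Fin n → ℤ) → Σ (λ i → - f i) ≡ - Σ f
Σ-neg {zero}  f = refl
Σ-neg {suc n} f =
  trans (cong (_+_ (- f zero)) (Σ-neg (f ∘ suc))) (sym (ℤP.neg-distrib-+ (f zero) _))

Σ-distrib-- : ∀ {n} (f g : Fin n → ℤ) → Σ (λ i → f i - g i) ≡ Σ f - Σ g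
Σ-distrib-- f g = trans (Σ-distrib-+ f (λ i → - g i)) (cong (_+_ (Σ f)) (Σ-neg g))

Σ-*ˡ : ∀ {n} c (f : Fin n → ℤ) → Σ (λ i → c * f i) ≡ c * Σ f
Σ-*ˡ {zero}  c f = sym (ℤP.*-zeroʳ c)
Σ-*ˡ {suc n} c f =
  trans (cong (_+_ (c * f zero)) (Σ-*ˡ c (f ∘ suc))) (sym (ℤP.*-distribˡ-+ c (f zero) _))

Σ-mono-≤ : ∀ {n} {f g : Fin n → ℤ} → (∀ i → f i ≤ g i) → Σ f ≤ Σ g
Σ-mono-≤ {zero}  f≤g = ℤP.≤-refl
Σ-mono-≤ {suc n} f≤g = ℤP.+-mono-≤ (f≤g zero) (Σ-mono-≤ (f≤g ∘ suc))

0≤Σ : ∀ {n} {f : Fin n → ℤ} → (∀ i → + 0 ≤ f i) → + 0 ≤ Σ f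
0≤Σ {zero}  0≤f = ℤP.≤-refl
0≤Σ {suc n} 0≤f = ℤP.+-mono-≤ (0≤f zero) (0≤Σ (0≤f ∘ suc))

term≤Σ : ∀ {n} {f : Fin n → ℤ} → (∀ i → + 0 ≤ f i) → ∀ i → f i ≤ Σ f
term≤Σ {suc n} {f} 0≤f zero =
  subst (_≤ Σ f) (ℤP.+-identityʳ (f zero)) (ℤP.+-monoʳ-≤ (f zero) (0≤Σ (0≤f ∘ suc)))
term≤Σ {suc n} {f} 0≤f (suc i) =
  subst (_≤ Σ f) (ℤP.+-identityˡ (f (suc i))) (ℤP.+-mono-≤ (0≤f zero) (term≤Σ (0≤f ∘ suc) i))

·e≡Σ : ∀ {n} (x : IVec n) → x · e ≡ Σ x
·e≡Σ x = Σ-cong (λ i → ℤP.*-identityʳ (x i))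

card≡Σχ : ∀ {n} (S : Subset n) → card S ≡ Σ (χ S)
card≡Σχ []          = refl
card≡Σχ (true ∷ S)  = cong (λ k → + 1 + k) (card≡Σχ S)
card≡Σχ (false ∷ S) = trans (card≡Σχ S) (sym (ℤP.+-identityˡ _))

i*i≡∣i∣*∣i∣ : ∀ i → i * i ≡ + ∣ i ∣ * + ∣ i ∣
i*i≡∣i∣*∣i∣ (+ n)    = refl
i*i≡∣i∣*∣i∣ -[1+ n ] = refl

i*i≡+[∣i∣*∣i∣] : ∀ i → i * i ≡ + (∣ i ∣ ℕ.* ∣ i ∣)
i*i≡+[∣i∣*∣i∣] i = trans (i*i≡∣i∣*∣i∣ i) (sym (ℤP.pos-* ∣ i ∣ ∣ i ∣))

0≤i*i : ∀ i → + 0 ≤ i * i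
0≤i*i i = subst (+ 0 ≤_) (sym (i*i≡+[∣i∣*∣i∣] i)) (+≤+ z≤n)

i*i≤n*n⇒∣i∣≤n : ∀ i n → i * i ≤ + (n ℕ.* n) → ∣ i ∣ ℕ.≤ n
i*i≤n*n⇒∣i∣≤n i n i*i≤n*n = ℕP.≮⇒≥ λ n<∣i∣ →
  ℕP.<⇒≱ (ℕP.*-mono-< n<∣i∣ n<∣i∣) (ℤP.drop‿+≤+ (subst (_≤ + (n ℕ.* n)) (i*i≡+[∣i∣*∣i∣] i) i*i≤n*n))

w·w≡n*n⇒∣wᵢ∣≤n : ∀ {d} (w : IVec d) n → w · w ≡ + (n ℕ.* n) → ∀ i → ∣ w i ∣ ℕ.≤ n
w·w≡n*n⇒∣wᵢ∣≤n w n w·w≡n*n i =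
  i*i≤n*n⇒∣i∣≤n (w i) n (subst (w i * w i ≤_) w·w≡n*n (term≤Σ (λ j → 0≤i*i (w j)) i))

[1+p]²*m≤4*p²⇒m≤3 : ∀ p {m} → (+ p + + 1) * (+ p + + 1) * + m ≤ + 4 * + (p ℕ.* p) → + m ≤ + 3
[1+p]²*m≤4*p²⇒m≤3 p {m} bound = +≤+ (ℕP.≮⇒≥ λ 3<m → ℕP.<⇒≱ (begin-strict
    4 ℕ.* (p ℕ.* p)   <⟨ ℕP.*-monoʳ-< 4 (ℕP.*-mono-< p<p+1 p<p+1) ⟩
    4 ℕ.* q           ≡⟨ ℕP.*-comm 4 q ⟩
    q ℕ.* 4           ≤⟨ ℕP.*-monoʳ-≤ q 3<m ⟩
    q ℕ.* m           ∎) (ℤP.drop‿+≤+ (subst₂ _≤_ lhs (sym (ℤP.pos-* 4 (p ℕ.* p))) bound)))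
  where
  open ℕP.≤-Reasoning
  q = (p ℕ.+ 1) ℕ.* (p ℕ.+ 1)
  p<p+1 : p ℕ.< p ℕ.+ 1
  p<p+1 = ℕP.m<m+n p (s≤s z≤n)
  lhs : (+ p + + 1) * (+ p + + 1) * + m ≡ + (q ℕ.* m)
  lhs = sym (trans (ℤP.pos-* q m) (cong (_* + m) (ℤP.pos-* (p ℕ.+ 1) (p ℕ.+ 1))))

n≤2∣i∣⇒n*n≤4*i*i : ∀ {n} i → n ℕ.≤ 2 ℕ.* ∣ i ∣ → + n * + n ≤ + 4 * (i * i)
n≤2∣i∣⇒n*n≤4*i*i {n} i n≤2∣i∣ = begin
  + n * + n                       ≡⟨ ℤP.pos-* n n ⟨
  + (n ℕ.* n)                     ≤⟨ +≤+ (ℕP.*-mono-≤ n≤2∣i∣ n≤2∣i∣) ⟩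
  + (2 ℕ.* ∣ i ∣ ℕ.* (2 ℕ.* ∣ i ∣)) ≡⟨ ℤP.pos-* (2 ℕ.* ∣ i ∣) (2 ℕ.* ∣ i ∣) ⟩
  + (2 ℕ.* ∣ i ∣) * + (2 ℕ.* ∣ i ∣) ≡⟨ cong₂ _*_ (ℤP.pos-* 2 ∣ i ∣) (ℤP.pos-* 2 ∣ i ∣) ⟩
  (+ 2 * + ∣ i ∣) * (+ 2 * + ∣ i ∣) ≡⟨ double-square (+ ∣ i ∣) ⟩
  + 4 * (+ ∣ i ∣ * + ∣ i ∣)         ≡⟨ cong (_*_ (+ 4)) (i*i≡∣i∣*∣i∣ i) ⟨
  + 4 * (i * i)                   ∎
  where
  open ℤP.≤-Reasoning
  double-square : ∀ x → (+ 2 * x) * (+ 2 * x) ≡ + 4 * (x * x)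
  double-square = solve-∀

∣a-c∣∧∣b-c∣⇒∣a-b : ∀ {m a b c} → m ∣ (a - c) → m ∣ (b - c) → m Signed.∣ (a - b)
∣a-c∣∧∣b-c∣⇒∣a-b {m} {a} {b} {c} m∣a-c m∣b-c =
  subst (m Signed.∣_) (cancel a b c)
    (Signed.∣m∣n⇒∣m-n (Signed.∣ᵤ⇒∣ {i = a - c} m∣a-c) (Signed.∣ᵤ⇒∣ {i = b - c} m∣b-c))
  where
  cancel : ∀ a b c → (a - c) - (b - c) ≡ a - b
  cancel = solve-∀

∣u-v∣∧∤v⇒u≢0 : ∀ {m u v} → m ∣ (u - v) → ¬ (m ∣ v) → u ≢ + 0
∣u-v∣∧∤v⇒u≢0 {m} {v = v} m∣u-v m∤v refl =
  m∤v (subst (∣ m ∣ ∣ℕ_) (trans (cong ∣_∣ (ℤP.+-identityˡ (- v))) (ℤP.∣-i∣≡∣i∣ v)) m∣u-v)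

≤q/2⇒2*<1+q : ∀ {a} q → a ℕ.≤ q / 2 → 2 ℕ.* a ℕ.< suc q
≤q/2⇒2*<1+q {a} q a≤q/2 = s≤s (begin
  2 ℕ.* a       ≤⟨ ℕP.*-monoʳ-≤ 2 a≤q/2 ⟩
  2 ℕ.* (q / 2) ≡⟨ ℕP.*-comm 2 (q / 2) ⟩
  q / 2 ℕ.* 2   ≤⟨ m/n*n≤m q 2 ⟩
  q             ∎)
  where open ℕP.≤-Reasoning

2*a<n⇒a<n : ∀ {a n} → 2 ℕ.* a ℕ.< n → a ℕ.< n
2*a<n⇒a<n {a} = ℕP.≤-<-trans (ℕP.m≤n*m a 2)

data Shift (p : ℕ) (u w : ℤ) : Set where
  kept    : w ≡ u → Shift p u w
  raised  : u < + 0 → w ≡ u + + p → Shift p u w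
  lowered : + 0 < u → w ≡ u - + p → Shift p u w

quotient-bound : ∀ {p u w k} → ∣ w ∣ ℕ.≤ p → ∣ u ∣ ℕ.< p → w - u ≡ k * + p → ∣ k ∣ ℕ.< 2
quotient-bound {p} {u} {w} {k} ∣w∣≤p ∣u∣<p w-u≡kp = ℕP.*-cancelʳ-< p ∣ k ∣ 2 (begin-strict
  ∣ k ∣ ℕ.* p     ≡⟨ ℤP.abs-* k (+ p) ⟨
  ∣ k * + p ∣     ≡⟨ cong ∣_∣ w-u≡kp ⟨
  ∣ w - u ∣       ≤⟨ ℤP.∣i-j∣≤∣i∣+∣j∣ w u ⟩
  ∣ w ∣ ℕ.+ ∣ u ∣ <⟨ ℕP.+-mono-≤-< ∣w∣≤p ∣u∣<p ⟩
  p ℕ.+ p         ≡⟨ cong (p ℕ.+_) (ℕP.+-identityʳ p) ⟨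
  2 ℕ.* p         ∎)
  where open ℕP.≤-Reasoning

∣i+n∣≤n⇒i<0 : ∀ {n} i → i ≢ + 0 → ∣ i + + n ∣ ℕ.≤ n → i < + 0
∣i+n∣≤n⇒i<0     (+ zero)  i≢0 _ = ⊥-elim (i≢0 refl)
∣i+n∣≤n⇒i<0 {n} +[1+ a ]  _   ∣i+n∣≤n =
  ⊥-elim (ℕP.m+1+n≰m n (subst (ℕ._≤ n) (ℕP.+-comm (suc a) n) ∣i+n∣≤n))
∣i+n∣≤n⇒i<0     -[1+ a ]  _   _ = -<+

∣i+n∣+∣i∣≡n : ∀ {i} n → i < + 0 → ∣ i ∣ ℕ.≤ n → ∣ i + + n ∣ ℕ.+ ∣ i ∣ ≡ n
∣i+n∣+∣i∣≡n {+ _}      n (+<+ ()) _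
∣i+n∣+∣i∣≡n { -[1+ a ]} n _ 1+a≤n rewrite ℤP.⊖-≥ 1+a≤n = ℕP.m∸n+n≡m 1+a≤n

-[i-j]≡-i+j : ∀ i j → - (i - j) ≡ - i + j
-[i-j]≡-i+j = solve-∀

∣i-n∣≡∣-i+n∣ : ∀ i n → ∣ i - + n ∣ ≡ ∣ - i + + n ∣
∣i-n∣≡∣-i+n∣ i n = trans (sym (ℤP.∣-i∣≡∣i∣ (i - + n))) (cong ∣_∣ (-[i-j]≡-i+j i (+ n)))

∣i-n∣≤n⇒0<i : ∀ {n} i → i ≢ + 0 → ∣ i - + n ∣ ℕ.≤ n → + 0 < i
∣i-n∣≤n⇒0<i {n} i i≢0 ∣i-n∣≤n = subst (+ 0 <_) (ℤP.neg-involutive i) (ℤP.neg-mono-<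
  (∣i+n∣≤n⇒i<0 (- i) (i≢0 ∘ ℤP.neg-injective) (subst (ℕ._≤ n) (∣i-n∣≡∣-i+n∣ i n) ∣i-n∣≤n)))

∣i-n∣+∣i∣≡n : ∀ {i} n → + 0 < i → ∣ i ∣ ℕ.≤ n → ∣ i - + n ∣ ℕ.+ ∣ i ∣ ≡ n
∣i-n∣+∣i∣≡n {i} n 0<i ∣i∣≤n =
  trans (cong₂ ℕ._+_ (∣i-n∣≡∣-i+n∣ i n) (sym (ℤP.∣-i∣≡∣i∣ i)))
        (∣i+n∣+∣i∣≡n n (ℤP.neg-mono-< 0<i) (subst (ℕ._≤ n) (sym (ℤP.∣-i∣≡∣i∣ i)) ∣i∣≤n))

b+a≡p∧2a<p⇒p+1≤2b : ∀ {a b p} → b ℕ.+ a ≡ p → 2 ℕ.* a ℕ.< p → p ℕ.+ 1 ℕ.≤ 2 ℕ.* b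
b+a≡p∧2a<p⇒p+1≤2b {a} {b} refl 2a<p = ℕP.+-cancelʳ-≤ (2 ℕ.* a) _ _ (begin
  p ℕ.+ 1 ℕ.+ 2 ℕ.* a     ≡⟨ ℕP.+-assoc p 1 (2 ℕ.* a) ⟩
  p ℕ.+ suc (2 ℕ.* a)     ≤⟨ ℕP.+-monoʳ-≤ p 2a<p ⟩
  p ℕ.+ p                 ≡⟨ cong (p ℕ.+_) (ℕP.+-identityʳ p) ⟨
  2 ℕ.* p                 ≡⟨ ℕP.*-distribˡ-+ 2 b a ⟩
  2 ℕ.* b ℕ.+ 2 ℕ.* a     ∎)
  where
  open ℕP.≤-Reasoning
  p = b ℕ.+ a

shift-of-congruence : ∀ {p u w} → u ≢ + 0 → 2 ℕ.* ∣ u ∣ ℕ.< p → ∣ w ∣ ℕ.≤ p →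
                      + p Signed.∣ (w - u) → Shift p u w
shift-of-congruence {p} {u} {w} u≢0 2∣u∣<p ∣w∣≤p (Signed.divides k w-u≡kp) =
  by-quotient k (quotient-bound {u = u} {w} {k} ∣w∣≤p (2*a<n⇒a<n 2∣u∣<p) w-u≡kp) w≡u+kp
  where
  w≡u+kp : w ≡ u + k * + p
  w≡u+kp = trans (w≡u+[w-u] u w) (cong (_+_ u) w-u≡kp)
    where
    w≡u+[w-u] : ∀ u w → w ≡ u + (w - u)
    w≡u+[w-u] = solve-∀

  by-quotient : ∀ k → ∣ k ∣ ℕ.< 2 → w ≡ u + k * + p → Shift p u w
  by-quotient (+ 0) _ w≡u+0p = kept (trans w≡u+0p (ℤP.+-identityʳ u))
  by-quotient (+ 1) _ w≡u+1p =
    raised (∣i+n∣≤n⇒i<0 u u≢0 (subst (λ x → ∣ x ∣ ℕ.≤ p) w≡u+p ∣w∣≤p)) w≡u+p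
    where
    w≡u+p : w ≡ u + + p
    w≡u+p = trans w≡u+1p (cong (_+_ u) (ℤP.*-identityˡ (+ p)))
  by-quotient -[1+ 0 ] _ w≡u-1p =
    lowered (∣i-n∣≤n⇒0<i u u≢0 (subst (λ x → ∣ x ∣ ℕ.≤ p) w≡u-p ∣w∣≤p)) w≡u-p
    where
    w≡u-p : w ≡ u - + p
    w≡u-p = trans w≡u-1p (cong (_+_ u) (ℤP.-1*i≡-i (+ p)))
  by-quotient +[1+ suc _ ] (s≤s (s≤s ()))
  by-quotient -[1+ suc _ ]  (s≤s (s≤s ()))

⟦_⟧ : Bool → ℤ
⟦ b ⟧ = if b then + 1 else + 0

isRaised isLowered : ∀ {p u w} → Shift p u w → Bool
isRaised (raised _ _) = true
isRaised _            = false
isLowered (lowered _ _) = true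
isLowered _             = false

shift-value : ∀ {p u w} (s : Shift p u w) → w ≡ u + + p * ⟦ isRaised s ⟧ - + p * ⟦ isLowered s ⟧
shift-value {p} {u} = λ where
    (kept refl)      → kept-value u (+ p)
    (raised _ refl)  → raised-value u (+ p)
    (lowered _ refl) → lowered-value u (+ p)
  where
  kept-value : ∀ u P → u ≡ u + P * + 0 - P * + 0
  kept-value = solve-∀
  raised-value : ∀ u P → u + P ≡ u + P * + 1 - P * + 0
  raised-value = solve-∀
  lowered-value : ∀ u P → u - P ≡ u + P * + 0 - P * + 1
  lowered-value = solve-∀

raised⇒u<0 : ∀ {p u w} (s : Shift p u w) → isRaised s ≡ true → u < + 0
raised⇒u<0 (raised u<0 _) _ = u<0

lowered⇒0<u : ∀ {p u w} (s : Shift p u w) → isLowered s ≡ true → + 0 < u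
lowered⇒0<u (lowered 0<u _) _ = 0<u

¬raised∧lowered : ∀ {p u w} (s : Shift p u w) → isRaised s ≡ true → ¬ (isLowered s ≡ true)
¬raised∧lowered (raised _ _) _ ()

shift-energy : ∀ {p u w} (s : Shift p u w) →
  + 2 * + p * (⟦ isRaised s ∨ isLowered s ⟧ * + ∣ u ∣)
    ≡ u * u - w * w + + p * + p * (⟦ isRaised s ⟧ + ⟦ isLowered s ⟧)
shift-energy {p} {u} = λ where
    (kept refl)            → kept-energy u (+ ∣ u ∣) (+ p)
    (raised -<+ refl)      → raised-energy (- u) (+ p)
    (lowered (+<+ _) refl) → lowered-energy u (+ p)
  where
  kept-energy : ∀ u a P → + 2 * P * (+ 0 * a) ≡ u * u - u * u + P * P * (+ 0 + + 0)
  kept-energy = solve-∀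
  raised-energy : ∀ a P → + 2 * P * (+ 1 * a) ≡ (- a) * (- a) - (- a + P) * (- a + P) + P * P * (+ 1 + + 0)
  raised-energy = solve-∀
  lowered-energy : ∀ a P → + 2 * P * (+ 1 * a) ≡ a * a - (a - P) * (a - P) + P * P * (+ 0 + + 1)
  lowered-energy = solve-∀

changed-mass : ∀ {p u} w → ∣ w ∣ ℕ.+ ∣ u ∣ ≡ p → 2 ℕ.* ∣ u ∣ ℕ.< p →
               (+ p + + 1) * (+ p + + 1) * + 1 ≤ + 4 * (w * w)
changed-mass {p} {u} w complement 2∣u∣<p =
  subst (_≤ + 4 * (w * w)) (sym (ℤP.*-identityʳ (+ (p ℕ.+ 1) * + (p ℕ.+ 1))))
    (n≤2∣i∣⇒n*n≤4*i*i w (b+a≡p∧2a<p⇒p+1≤2b {∣ u ∣} {∣ w ∣} complement 2∣u∣<p))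

shift-mass : ∀ {p u w} (s : Shift p u w) → 2 ℕ.* ∣ u ∣ ℕ.< p →
  (+ p + + 1) * (+ p + + 1) * (⟦ isRaised s ⟧ + ⟦ isLowered s ⟧) ≤ + 4 * (w * w)
shift-mass {p} {w = w} (kept _) _ =
  subst (_≤ + 4 * (w * w)) (sym (ℤP.*-zeroʳ (+ (p ℕ.+ 1) * + (p ℕ.+ 1))))
    (n≤2∣i∣⇒n*n≤4*i*i w z≤n)
shift-mass {p} {u} (raised u<0 refl) 2∣u∣<p = changed-mass {u = u} (u + + p)
  (∣i+n∣+∣i∣≡n p u<0 (ℕP.<⇒≤ (2*a<n⇒a<n {∣ u ∣} 2∣u∣<p))) 2∣u∣<p
shift-mass {p} {u} (lowered 0<u refl) 2∣u∣<p = changed-mass {u = u} (u - + p)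
  (∣i-n∣+∣i∣≡n p 0<u (ℕP.<⇒≤ (2*a<n⇒a<n {∣ u ∣} 2∣u∣<p))) 2∣u∣<p

module ShiftedVector {n p} {u w : IVec n} (shift : ∀ i → Shift p (u i) (w i)) where

  I D : Subset n
  I = tabulate (isRaised ∘ shift)
  D = tabulate (isLowered ∘ shift)

  χI≡raised : ∀ i → χ I i ≡ ⟦ isRaised (shift i) ⟧
  χI≡raised i = cong ⟦_⟧ (VP.lookup∘tabulate (isRaised ∘ shift) i)

  χD≡lowered : ∀ i → χ D i ≡ ⟦ isLowered (shift i) ⟧
  χD≡lowered i = cong ⟦_⟧ (VP.lookup∘tabulate (isLowered ∘ shift) i)

  χI∪D≡changed : ∀ i → χ (I ∪ D) i ≡ ⟦ isRaised (shift i) ∨ isLowered (shift i) ⟧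
  χI∪D≡changed i = cong ⟦_⟧ (trans (VP.lookup-zipWith _∨_ i I D)
    (cong₂ _∨_ (VP.lookup∘tabulate (isRaised ∘ shift) i) (VP.lookup∘tabulate (isLowered ∘ shift) i)))

  ∈I⇒raised : ∀ {i} → i ∈ I → isRaised (shift i) ≡ true
  ∈I⇒raised {i} i∈I = trans (sym (VP.lookup∘tabulate (isRaised ∘ shift) i)) (VP.[]=⇒lookup i∈I)

  ∈D⇒lowered : ∀ {i} → i ∈ D → isLowered (shift i) ≡ true
  ∈D⇒lowered {i} i∈D = trans (sym (VP.lookup∘tabulate (isLowered ∘ shift) i)) (VP.[]=⇒lookup i∈D)

  I-D-disjoint : Disjoint I D
  I-D-disjoint i i∈I i∈D = ¬raised∧lowered (shift i) (∈I⇒raised i∈I) (∈D⇒lowered i∈D)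

  ∈I⇒u<0 : ∀ i → i ∈ I → u i < + 0
  ∈I⇒u<0 i i∈I = raised⇒u<0 (shift i) (∈I⇒raised i∈I)

  ∈D⇒0<u : ∀ i → i ∈ D → + 0 < u i
  ∈D⇒0<u i i∈D = lowered⇒0<u (shift i) (∈D⇒lowered i∈D)

  w≡u+pχI-pχD : ∀ i → w i ≡ u i + + p * χ I i - + p * χ D i
  w≡u+pχI-pχD i = trans (shift-value (shift i))
    (sym (cong₂ (λ r l → u i + + p * r - + p * l) (χI≡raised i) (χD≡lowered i)))

  ΣχI+χD≡card : Σ (λ i → χ I i + χ D i) ≡ card I + card D
  ΣχI+χD≡card = trans (Σ-distrib-+ (χ I) (χ D)) (sym (cong₂ _+_ (card≡Σχ I) (card≡Σχ D)))

  Σw≡Σu+p∣I∣-p∣D∣ : Σ w ≡ Σ u + + p * card I - + p * card D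
  Σw≡Σu+p∣I∣-p∣D∣ = begin
    Σ w                                                   ≡⟨ Σ-cong w≡u+pχI-pχD ⟩
    Σ (λ i → u i + + p * χ I i - + p * χ D i)             ≡⟨ Σ-distrib-- _ (λ i → + p * χ D i) ⟩
    Σ (λ i → u i + + p * χ I i) - Σ (λ i → + p * χ D i)   ≡⟨ cong₂ _-_ (Σ-distrib-+ u (λ i → + p * χ I i))
                                                                        (Σ-*ˡ (+ p) (χ D)) ⟩
    Σ u + Σ (λ i → + p * χ I i) - + p * Σ (χ D)           ≡⟨ cong (λ x → Σ u + x - + p * Σ (χ D)) (Σ-*ˡ (+ p) (χ I)) ⟩
    Σ u + + p * Σ (χ I) - + p * Σ (χ D)                   ≡⟨ cong₂ (λ a b → Σ u + + p * a - + p * b) (card≡Σχ I) (card≡Σχ D) ⟨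
    Σ u + + p * card I - + p * card D                     ∎
    where open ≡-Reasoning

  energy : + 2 * + p * Σ (λ k → χ (I ∪ D) k * + ∣ u k ∣)
             ≡ u · u - w · w + + p * + p * (card I + card D)
  energy = begin
    + 2 * + p * Σ (λ k → χ (I ∪ D) k * + ∣ u k ∣)
      ≡⟨ Σ-*ˡ (+ 2 * + p) (λ k → χ (I ∪ D) k * + ∣ u k ∣) ⟨
    Σ (λ k → + 2 * + p * (χ (I ∪ D) k * + ∣ u k ∣))
      ≡⟨ Σ-cong entry ⟩
    Σ (λ k → (u k * u k - w k * w k) + + p * + p * (χ I k + χ D k))
      ≡⟨ Σ-distrib-+ (λ k → u k * u k - w k * w k) (λ k → + p * + p * (χ I k + χ D k)) ⟩
    Σ (λ k → u k * u k - w k * w k) + Σ (λ k → + p * + p * (χ I k + χ D k))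
      ≡⟨ cong₂ _+_ (Σ-distrib-- (λ k → u k * u k) (λ k → w k * w k))
                   (trans (Σ-*ˡ (+ p * + p) (λ k → χ I k + χ D k)) (cong (_*_ (+ p * + p)) ΣχI+χD≡card)) ⟩
    u · u - w · w + + p * + p * (card I + card D)
      ∎
    where
    open ≡-Reasoning
    entry : ∀ k → + 2 * + p * (χ (I ∪ D) k * + ∣ u k ∣)
                    ≡ (u k * u k - w k * w k) + + p * + p * (χ I k + χ D k)
    entry k = trans (cong (λ c → + 2 * + p * (c * + ∣ u k ∣)) (χI∪D≡changed k))
      (trans (shift-energy (shift k))
        (sym (cong₂ (λ r l → u k * u k - w k * w k + + p * + p * (r + l)) (χI≡raised k) (χD≡lowered k))))

  mass : (∀ i → 2 ℕ.* ∣ u i ∣ ℕ.< p) →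
         (+ p + + 1) * (+ p + + 1) * (card I + card D) ≤ + 4 * (w · w)
  mass short = begin
    Q * (card I + card D)                 ≡⟨ cong (_*_ Q) ΣχI+χD≡card ⟨
    Q * Σ (λ k → χ I k + χ D k)           ≡⟨ Σ-*ˡ Q (λ k → χ I k + χ D k) ⟨
    Σ (λ k → Q * (χ I k + χ D k))         ≤⟨ Σ-mono-≤ entry ⟩
    Σ (λ k → + 4 * (w k * w k))           ≡⟨ Σ-*ˡ (+ 4) (λ k → w k * w k) ⟩
    + 4 * (w · w)                         ∎
    where
    open ℤP.≤-Reasoning
    Q = (+ p + + 1) * (+ p + + 1)
    entry : ∀ k → Q * (χ I k + χ D k) ≤ + 4 * (w k * w k)
    entry k = subst (_≤ + 4 * (w k * w k))
      (sym (cong₂ (λ r l → Q * (r + l)) (χI≡raised k) (χD≡lowered k)))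
      (shift-mass (shift k) (short k))

  card-balance : ∀ {s} .{{_ : ℕ.NonZero p}} → w · e ≡ + p → u · e - + p ≡ s * + p → card D - card I ≡ s
  card-balance {s} w·e≡p u·e-p≡sp = ℤP.*-cancelˡ-≡ (+ p) (card D - card I) s (begin
    + p * (card D - card I)                         ≡⟨ rearrange (Σ u) (+ p) (card I) (card D) ⟩
    Σ u - (Σ u + + p * card I - + p * card D)       ≡⟨ cong (_-_ (Σ u)) Σw≡Σu+p∣I∣-p∣D∣ ⟨
    Σ u - Σ w                                       ≡⟨ cong (_-_ (Σ u)) (trans (sym (·e≡Σ w)) w·e≡p) ⟩
    Σ u - + p                                       ≡⟨ cong (_- + p) (·e≡Σ u) ⟨
    u · e - + p                                     ≡⟨ u·e-p≡sp ⟩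
    s * + p                                         ≡⟨ ℤP.*-comm s (+ p) ⟩
    + p * s                                         ∎)
    where
    open ≡-Reasoning
    rearrange : ∀ a P c d → P * (d - c) ≡ a - (a + P * c - P * d)
    rearrange = solve-∀

  module _ (w·w≡p² : w · w ≡ + (p ℕ.* p)) where

    at-most-three : (∀ i → 2 ℕ.* ∣ u i ∣ ℕ.< p) → card I + card D ≤ + 3
    at-most-three short = [1+p]²*m≤4*p²⇒m≤3 p
      (subst (λ x → (+ p + + 1) * (+ p + + 1) * (card I + card D) ≤ + 4 * x) w·w≡p² (mass short))

    perfect-energy : + 2 * + p * Σ (λ k → χ (I ∪ D) k * + ∣ u k ∣)
                       ≡ u · u + + p * + p * (card I + card D - + 1)
    perfect-energy = begin
      + 2 * + p * Σ (λ k → χ (I ∪ D) k * + ∣ u k ∣)   ≡⟨ energy ⟩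
      u · u - w · w + + p * + p * (card I + card D)   ≡⟨ cong (λ x → u · u - x + + p * + p * (card I + card D))
                                                              (trans w·w≡p² (ℤP.pos-* p p)) ⟩
      u · u - + p * + p + + p * + p * (card I + card D) ≡⟨ collect (u · u) (+ p) (card I + card D) ⟩
      u · u + + p * + p * (card I + card D - + 1)     ∎
      where
      open ≡-Reasoning
      collect : ∀ a P c → a - P * P + P * P * c ≡ a + P * P * (c - + 1)
      collect = solve-∀

lemma3p10 : ∀ (p n : ℕ) → Prime p → p ≢ 2 →
    (v u : IVec n) → (∀ i → ¬ (+ p ∣ v i)) →
    IsShortestRep p v u →
    (s : ℤ) → - (+ 3) ≤ s → s ≤ + 3 → u · e - + p ≡ s * + p →
    u · u ≤ + (p ℕ.* p) →
    (w : IVec n) → IsPerfectRep p v w →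
    Σ[ I ∈ Subset n ] Σ[ D ∈ Subset n ]
      ( Disjoint I D
      × (∀ i → w i ≡ u i + + p * χ I i - + p * χ D i)
      × (card I + card D ≤ + 3)
      × (card D - card I ≡ s)
      × (∀ i → i ∈ I → u i < + 0)
      × (∀ j → j ∈ D → + 0 < u j)
      × (+ 2 * + p * Σ (λ k → χ (I ∪ D) k * + ∣ u k ∣)
           ≡ u · u + + p * + p * (card I + card D - + 1)) )
lemma3p10 zero _ 0-prime = ⊥-elim (¬prime[0] 0-prime)
lemma3p10 p@(suc q) n _ _ v u p∤v (u≡v , u-short) s _ _ u·e-p≡sp _ w (w≡v , w·e≡p , w·w≡p²) =
  I , D , I-D-disjoint , w≡u+pχI-pχD , at-most-three w·w≡p² short , card-balance w·e≡p u·e-p≡sp ,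
  ∈I⇒u<0 , ∈D⇒0<u , perfect-energy w·w≡p²
  where
  short : ∀ i → 2 ℕ.* ∣ u i ∣ ℕ.< p
  short i = ≤q/2⇒2*<1+q q (u-short i)

  shift : ∀ i → Shift p (u i) (w i)
  shift i = shift-of-congruence (∣u-v∣∧∤v⇒u≢0 {+ p} (u≡v i) (p∤v i)) (short i)
    (w·w≡n*n⇒∣wᵢ∣≤n w p w·w≡p² i) (∣a-c∣∧∣b-c∣⇒∣a-b {+ p} {w i} {u i} {v i} (w≡v i) (u≡v i))

  open ShiftedVector shift
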